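{- Let $(G,\mathcal{T},(A^\circ,B^\circ),k)$ be a Terminal Separation instance in which $(A^\circ,B^\circ)$ is maximal. If $A$ is a terminal-free $A^\circ$-extension with $d(A) - d(A^\circ) = 1$, then there exists an integral terminal separation $(A^\ast,B^\ast)$ extending $(A^\circ,B^\circ)$, of minimum cost among all integral terminal separations extending $(A^\circ,B^\circ)$, such that $A\setminus A^\circ \subseteq A^\ast$ or $A\setminus A^\circ\subseteq B^\ast$.
   Context: Graphs may have multiple edges but no loops; $d(A)$ is the number of edges with exactly one endpoint in $A$. A terminal separation for a family $\mathcal{T}$ of pairwise disjoint terminal pairs is a pair $(A,B)$ of disjoint vertex sets such that every pair either has one terminal in $A$ and the other in $B$, or is disjoint from $A\cup B$; it is integral if $A\cup B=V(G)$; $(A',B')$ extends $(A,B)$ if $A\subseteq A'$, $B\subseteq B'$; its cost is $(d(A)+d(B))/2$. In the instance, every terminal has degree at most one, and $(A^\circ,B^\circ)$ is a terminal separation; it is maximal if every other terminal separation extending it has strictly larger cost. A set $A$ is an $A^\circ$-extension if $A^\circ\subseteq A\subseteq V(G)\setminus B^\circ$; it is terminal-free if $A\setminus A^\circ$ contains no terminal. -}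

module Defs where

open import Data.Nat using (ℕ; zero; suc; _+_; _≤_; _<_)
open import Data.Bool using (Bool; true; false; _xor_)
open import Data.Fin using (Fin)
open import Data.List using (List; []; _∷_; concatMap)
open import Data.List.Relation.Unary.All using (All)
open import Data.List.Relation.Unary.Any using (Any)
open import Data.List.Relation.Unary.Unique.Propositional using (Unique)
open import Data.Product using (_×_; _,_; proj₁; proj₂)
open import Data.Sum using (_⊎_)
open import Relation.Binary.PropositionalEquality using (_≡_; _≢_)
open import Relation.Nullary using (¬_)

-- A multigraph without loops on vertex set Fin n: a list of edges
-- (repetitions = parallel edges), each with two distinct endpoints.
record Graph (n : ℕ) : Set where
  field
    edges   : List (Fin n × Fin n)
    noLoops : All (λ e → proj₁ e ≢ proj₂ e) edges
open Graph public

VSet : ℕ → Set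
VSet n = Fin n → Bool

_∈_ : ∀ {n} → Fin n → VSet n → Set
v ∈ A = A v ≡ true

_∉_ : ∀ {n} → Fin n → VSet n → Set
v ∉ A = A v ≡ false

count : ∀ {X : Set} → (X → Bool) → List X → ℕ
count p [] = 0
count p (x ∷ xs) with p x
... | true  = suc (count p xs)
... | false = count p xs

d : ∀ {n} → Graph n → VSet n → ℕ
d G A = count (λ e → A (proj₁ e) xor A (proj₂ e)) (edges G)

incident : ∀ {n} → Fin n → Fin n × Fin n → Set
incident v e = (proj₁ e ≡ v) ⊎ (proj₂ e ≡ v)

degree : ∀ {n} → Graph n → Fin n → ℕ
degree G v = Data.List.length (Data.List.filter (λ e → Data.Fin._≟_ (proj₁ e) v Relation.Nullary.Decidable.⊎-dec Data.Fin._≟_ (proj₂ e) v) (edges G))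
  where import Relation.Nullary.Decidable
        import Data.Fin

Pairs : ℕ → Set
Pairs n = List (Fin n × Fin n)

terminals : ∀ {n} → Pairs n → List (Fin n)
terminals = concatMap (λ p → proj₁ p ∷ proj₂ p ∷ [])

-- pairwise disjoint pairs (each pair of two distinct terminals)
PairwiseDisjoint : ∀ {n} → Pairs n → Set
PairwiseDisjoint T = Unique (terminals T)

IsTerminal : ∀ {n} → Pairs n → Fin n → Set
IsTerminal T v = Any (v ≡_) (terminals T)

IsTerminalSeparation : ∀ {n} → Pairs n → VSet n → VSet n → Set
IsTerminalSeparation T A B =
  (∀ v → ¬ (v ∈ A × v ∈ B)) ×
  All (λ p → ((proj₁ p ∈ A × proj₂ p ∈ B) ⊎ (proj₂ p ∈ A × proj₁ p ∈ B))
           ⊎ (proj₁ p ∉ A × proj₁ p ∉ B × proj₂ p ∉ A × proj₂ p ∉ B)) T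

Integral : ∀ {n} → VSet n → VSet n → Set
Integral A B = ∀ v → v ∈ A ⊎ v ∈ B

Extends : ∀ {n} → VSet n → VSet n → VSet n → VSet n → Set
Extends A' B' A B = (∀ v → v ∈ A → v ∈ A') × (∀ v → v ∈ B → v ∈ B')

-- twice the cost: cost(A,B) = (d(A)+d(B))/2; we compare 2·cost
cost2 : ∀ {n} → Graph n → VSet n → VSet n → ℕ
cost2 G A B = d G A + d G B

SameSep : ∀ {n} → VSet n → VSet n → VSet n → VSet n → Set
SameSep A' B' A B = ∀ v → (A' v ≡ A v) × (B' v ≡ B v)

record Instance (n : ℕ) : Set where
  field
    G        : Graph n
    T        : Pairs n
    disj     : PairwiseDisjoint T
    A°       : VSet n
    B°       : VSet n
    sep°     : IsTerminalSeparation T A° B°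
    k        : ℕ
    termDeg  : ∀ v → IsTerminal T v → degree G v ≤ 1
open Instance public

Maximal : ∀ {n} → Instance n → Set
Maximal I = ∀ A' B' → IsTerminalSeparation (T I) A' B' → Extends A' B' (A° I) (B° I)
          → ¬ SameSep A' B' (A° I) (B° I) → cost2 (G I) (A° I) (B° I) < cost2 (G I) A' B'

IsExtension : ∀ {n} → Instance n → VSet n → Set
IsExtension I A = (∀ v → v ∈ A° I → v ∈ A) × (∀ v → v ∈ A → v ∉ B° I)

TerminalFree : ∀ {n} → Instance n → VSet n → Set
TerminalFree I A = ∀ v → v ∈ A → v ∉ A° I → ¬ IsTerminal (T I) v

-- The cut function d is submodular: d(X ∪ Y) + d(X ∩ Y) ≤ d(X) + d(Y).
-- Take a minimum-cost integral separation (X, V ∖ X) extending (A°, B°).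
-- If X misses A ∖ A°, then A ∖ A° ⊆ V ∖ X. Otherwise (X ∩ A, B°) is a terminal
-- separation (A is terminal-free) strictly extending (A°, B°), so maximality
-- gives d(X ∩ A) > d(A°), that is d(X ∩ A) ≥ d(A). Submodularity then yields
-- d(X ∪ A) ≤ d(X), and since X ∪ A agrees with X on the terminals, it is again
-- a minimum-cost integral separation, now containing A.
module Submission where

open import Defs
open import Data.Nat using (ℕ; suc; _≤_)
open import Data.Product using (Σ; _×_)
open import Data.Sum using (_⊎_)
open import Relation.Binary.PropositionalEquality using (_≡_)

open import Data.Bool using (Bool; true; false; not; _∧_; _∨_; _xor_)
open import Data.Bool.Properties using (_≟_; ∨-zeroʳ; not-involutive; not-injective; not-¬; ¬-not)
open import Data.Empty using (⊥-elim)
open import Data.Fin using (Fin)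
open import Data.Fin.Properties using (any?; all?)
open import Data.Fin.Subset.Properties using (anySubset?)
open import Data.List using (List; []; _∷_)
open import Data.List.Relation.Unary.All as All using (All; []; _∷_)
open import Data.List.Relation.Unary.AllPairs using (_∷_)
open import Data.List.Relation.Unary.Any using (here; there)
open import Data.Nat using (zero; _+_; z≤n; _≤?_)
open import Data.Nat.Properties
  using (+-commutativeSemigroup; ≤-refl; ≤-trans; ≰⇒>; +-mono-≤; +-monoʳ-≤; +-cancelʳ-≤; +-cancelʳ-<; module ≤-Reasoning)
open import Algebra.Properties.CommutativeSemigroup +-commutativeSemigroup using (interchange)
open import Data.Product using (∃; _,_; proj₁; proj₂)
open import Data.Sum using (inj₁; inj₂)
open import Data.Vec using (lookup; tabulate)
open import Data.Vec.Properties using (lookup∘tabulate)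
open import Data.Vec.Functional using (updateAt)
open import Data.Vec.Functional.Properties using (updateAt-updates; updateAt-minimal)
open import Function using (_∘_; const)
open import Relation.Binary.PropositionalEquality
  using (refl; sym; trans; cong; cong₂; subst; subst₂; _≗_; ≢-sym; _≢_; module ≡-Reasoning)
open import Relation.Nullary using (¬_; Dec; yes; no)
open import Relation.Nullary.Decidable using (map′; _×-dec_; _→-dec_; True; toWitness)

private
  variable
    n : ℕ
    X Y : VSet n
    s t v : Fin n

∁ : VSet n → VSet n
∁ X v = not (X v)

infixr 25 _∪_ _∩_

_∪_ _∩_ : VSet n → VSet n → VSet n
(X ∪ Y) v = X v ∨ Y v
(X ∩ Y) v = X v ∧ Y v

_⊆_ : VSet n → VSet n → Set
X ⊆ Y = ∀ v → v ∈ X → v ∈ Y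

Disjoint : VSet n → VSet n → Set
Disjoint X Y = ∀ v → ¬ (v ∈ X × v ∈ Y)

∈∁⇒∉ : v ∈ ∁ X → v ∉ X
∈∁⇒∉ = not-injective

∉⇒∈∁ : v ∉ X → v ∈ ∁ X
∉⇒∈∁ = cong not

∈∉⇒≢ : v ∈ X → s ∉ X → v ≢ s
∈∉⇒≢ v∈X s∉X refl = not-¬ v∈X s∉X

∪⁺ʳ : v ∈ Y → v ∈ X ∪ Y
∪⁺ʳ {v = v} {X = X} v∈Y = trans (cong (X v ∨_) v∈Y) (∨-zeroʳ (X v))

∪-∉ : v ∉ X → v ∉ Y → v ∉ X ∪ Y
∪-∉ v∉X v∉Y rewrite v∉X | v∉Y = refl

∩⁺ : v ∈ X → v ∈ Y → v ∈ X ∩ Y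
∩⁺ v∈X v∈Y rewrite v∈X | v∈Y = refl

∧-≡-trueʳ : ∀ a {b} → a ∧ b ≡ true → b ≡ true
∧-≡-trueʳ true a∧b≡true = a∧b≡true

∩⁻ʳ : v ∈ X ∩ Y → v ∈ Y
∩⁻ʳ {v = v} {X = X} = ∧-≡-trueʳ (X v)

∨-absorbs-below : ∀ {a b} → (b ≡ true → a ≡ true) → a ∨ b ≡ a
∨-absorbs-below {true}          _ = refl
∨-absorbs-below {false} {false} _ = refl
∨-absorbs-below {false} {true}  b≤a = sym (b≤a refl)

∧-absorbs-below : ∀ {a b} → (b ≡ true → a ≡ true) → a ∧ b ≡ b
∧-absorbs-below {true}          _ = refl
∧-absorbs-below {false} {false} _ = refl
∧-absorbs-below {false} {true}  b≤a = b≤a refl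

disjoint⇒∉ : Disjoint X Y → v ∈ Y → v ∉ X
disjoint⇒∉ disjoint v∈Y = ¬-not λ v∈X → disjoint _ (v∈X , v∈Y)

⊆∁⇒disjoint : (∀ v → v ∈ X → v ∉ Y) → Disjoint X Y
⊆∁⇒disjoint X-avoids-Y v (v∈X , v∈Y) = not-¬ v∈Y (X-avoids-Y v v∈X)

disjoint-total⇒≗∁ : Disjoint X Y → Integral X Y → Y ≗ ∁ X
disjoint-total⇒≗∁ {X = X} {Y = Y} disjoint total v with X v | Y v | disjoint v | total v
... | true  | false | _     | _    = refl
... | false | true  | _     | _    = refl
... | true  | true  | ¬both | _    = ⊥-elim (¬both (refl , refl))
... | false | false | _     | inj₁ ()
... | false | false | _     | inj₂ ()

∁-integral : (X : VSet n) → Integral X (∁ X)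
∁-integral X v with X v
... | true  = inj₁ refl
... | false = inj₂ refl

indicator : Bool → ℕ
indicator true  = 1
indicator false = 0

count-∷ : ∀ {E : Set} (p : E → Bool) x xs → count p (x ∷ xs) ≡ indicator (p x) + count p xs
count-∷ p x xs with p x
... | true  = refl
... | false = refl

count-cong : ∀ {E : Set} {p q : E → Bool} (xs : List E) → p ≗ q → count p xs ≡ count q xs
count-cong [] _ = refl
count-cong {p = p} {q} (x ∷ xs) p≗q = begin
  count p (x ∷ xs)              ≡⟨ count-∷ p x xs ⟩
  indicator (p x) + count p xs  ≡⟨ cong₂ _+_ (cong indicator (p≗q x)) (count-cong xs p≗q) ⟩
  indicator (q x) + count q xs  ≡⟨ count-∷ q x xs ⟨
  count q (x ∷ xs)              ∎
  where open ≡-Reasoning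

count-+-mono-≤ : ∀ {E : Set} {p q r s : E → Bool} (xs : List E) →
  (∀ x → indicator (p x) + indicator (q x) ≤ indicator (r x) + indicator (s x)) →
  count p xs + count q xs ≤ count r xs + count s xs
count-+-mono-≤ [] _ = z≤n
count-+-mono-≤ {p = p} {q} {r} {s} (x ∷ xs) pointwise = begin
  count p (x ∷ xs) + count q (x ∷ xs)
    ≡⟨ cong₂ _+_ (count-∷ p x xs) (count-∷ q x xs) ⟩
  (indicator (p x) + count p xs) + (indicator (q x) + count q xs)
    ≡⟨ interchange (indicator (p x)) (count p xs) (indicator (q x)) (count q xs) ⟩
  (indicator (p x) + indicator (q x)) + (count p xs + count q xs)
    ≤⟨ +-mono-≤ (pointwise x) (count-+-mono-≤ xs pointwise) ⟩
  (indicator (r x) + indicator (s x)) + (count r xs + count s xs)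
    ≡⟨ interchange (indicator (r x)) (indicator (s x)) (count r xs) (count s xs) ⟩
  (indicator (r x) + count r xs) + (indicator (s x) + count s xs)
    ≡⟨ cong₂ _+_ (count-∷ r x xs) (count-∷ s x xs) ⟨
  count r (x ∷ xs) + count s (x ∷ xs) ∎
  where open ≤-Reasoning

cut : VSet n → Fin n × Fin n → Bool
cut X (u , w) = X u xor X w

cut-∈∉ : s ∈ X → t ∉ X → cut X (s , t) ≡ true
cut-∈∉ s∈X t∉X rewrite s∈X | t∉X = refl

cut-∉∈ : s ∉ X → t ∈ X → cut X (s , t) ≡ true
cut-∉∈ s∉X t∈X rewrite s∉X | t∈X = refl

cut-submodular : ∀ a b c e →
  indicator ((a ∨ b) xor (c ∨ e)) + indicator ((a ∧ b) xor (c ∧ e)) ≤ indicator (a xor c) + indicator (b xor e)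
cut-submodular a b c e = toWitness (by-cases a b c e)
  where
  by-cases : ∀ a b c e → True (indicator ((a ∨ b) xor (c ∨ e)) + indicator ((a ∧ b) xor (c ∧ e))
                                  ≤? indicator (a xor c) + indicator (b xor e))
  by-cases true  true  true  true  = _
  by-cases true  true  true  false = _
  by-cases true  true  false true  = _
  by-cases true  true  false false = _
  by-cases true  false true  true  = _
  by-cases true  false true  false = _
  by-cases true  false false true  = _
  by-cases true  false false false = _
  by-cases false true  true  true  = _
  by-cases false true  true  false = _
  by-cases false true  false true  = _
  by-cases false true  false false = _
  by-cases false false true  true  = _
  by-cases false false true  false = _
  by-cases false false false true  = _
  by-cases false false false false = _

not-xor-not : ∀ a b → not a xor not b ≡ a xor b
not-xor-not true  b = refl
not-xor-not false b = not-involutive b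

d-cong : (G : Graph n) → X ≗ Y → d G X ≡ d G Y
d-cong G X≗Y = count-cong (edges G) λ (u , w) → cong₂ _xor_ (X≗Y u) (X≗Y w)

d-∁ : (G : Graph n) (X : VSet n) → d G (∁ X) ≡ d G X
d-∁ G X = count-cong (edges G) λ (u , w) → not-xor-not (X u) (X w)

d-submodular : (G : Graph n) (X Y : VSet n) → d G (X ∪ Y) + d G (X ∩ Y) ≤ d G X + d G Y
d-submodular G X Y = count-+-mono-≤ (edges G) λ (u , w) → cut-submodular (X u) (Y u) (X w) (Y w)

module _ {P : VSet n → Set} (P? : ∀ X → Dec (P X)) (P-resp : ∀ {X Y} → X ≗ Y → P X → P Y) where

  any-VSet? : Dec (∃ P)
  any-VSet? = map′ (λ (xs , p) → lookup xs , p)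
                   (λ (X , p) → tabulate X , P-resp (sym ∘ lookup∘tabulate X) p)
                   (anySubset? (P? ∘ lookup))

Minimiser : (VSet n → Set) → (VSet n → ℕ) → VSet n → Set
Minimiser P f X = P X × (∀ Y → P Y → f X ≤ f Y)

module _ {P : VSet n → Set} (P? : ∀ X → Dec (P X)) (P-resp : ∀ {X Y} → X ≗ Y → P X → P Y)
         (f : VSet n → ℕ) (f-resp : ∀ {X Y} → X ≗ Y → f X ≡ f Y) where

  private
    Below : ℕ → VSet n → Set
    Below m X = P X × f X ≤ m

    below? : ∀ m → Dec (∃ (Below m))
    below? m = any-VSet? (λ X → P? X ×-dec f X ≤? m)
                         (λ X≗Y (p , fX≤m) → P-resp X≗Y p , subst (_≤ m) (f-resp X≗Y) fX≤m)

    minimiser-below : ∀ m → ∃ (Below m) → ∃ (Minimiser P f)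
    minimiser-below zero    (X , p , fX≤0) = X , p , λ _ _ → ≤-trans fX≤0 z≤n
    minimiser-below (suc m) (X , p , fX≤1+m) with below? m
    ... | yes below = minimiser-below m below
    ... | no  none  = X , p , λ Y pY → ≤-trans fX≤1+m (≰⇒> λ fY≤m → none (Y , pY , fY≤m))

  minimiser : ∃ P → ∃ (Minimiser P f)
  minimiser (X , p) = minimiser-below (f X) (X , p , ≤-refl)

PairSeparated : VSet n → VSet n → Fin n × Fin n → Set
PairSeparated A B (s , t) = ((s ∈ A × t ∈ B) ⊎ (t ∈ A × s ∈ B)) ⊎ (s ∉ A × s ∉ B × t ∉ A × t ∉ B)

Splits : Pairs n → VSet n → Set
Splits T X = All (λ p → cut X p ≡ true) T

AgreeOnTerminals : Pairs n → VSet n → VSet n → Set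
AgreeOnTerminals T X Y = ∀ v → IsTerminal T v → X v ≡ Y v

All-pairs-cong : {Q : VSet n → Fin n × Fin n → Set} →
  (∀ {X Y s t} → X s ≡ Y s → X t ≡ Y t → Q X (s , t) → Q Y (s , t)) →
  ∀ T → AgreeOnTerminals T X Y → All (Q X) T → All (Q Y) T
All-pairs-cong Q-local []      _     []       = []
All-pairs-cong Q-local (_ ∷ T) agree (q ∷ qs) =
  Q-local (agree _ (here refl)) (agree _ (there (here refl))) q
    ∷ All-pairs-cong Q-local T (λ v → agree v ∘ there ∘ there) qs

splits-cong : ∀ T → AgreeOnTerminals T X Y → Splits T X → Splits T Y
splits-cong = All-pairs-cong λ Xs≡Ys Xt≡Yt → subst₂ (λ a b → a xor b ≡ true) Xs≡Ys Xt≡Yt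

pair-separated-congˡ : ∀ {A A' B : VSet n} → A s ≡ A' s → A t ≡ A' t →
  PairSeparated A B (s , t) → PairSeparated A' B (s , t)
pair-separated-congˡ As≡ _   (inj₁ (inj₁ (s∈A , t∈B))) = inj₁ (inj₁ (trans (sym As≡) s∈A , t∈B))
pair-separated-congˡ _   At≡ (inj₁ (inj₂ (t∈A , s∈B))) = inj₁ (inj₂ (trans (sym At≡) t∈A , s∈B))
pair-separated-congˡ As≡ At≡ (inj₂ (s∉A , s∉B , t∉A , t∉B)) =
  inj₂ (trans (sym As≡) s∉A , s∉B , trans (sym At≡) t∉A , t∉B)

pairs-separated-congˡ : ∀ {A A' B : VSet n} T → AgreeOnTerminals T A A' →
  All (PairSeparated A B) T → All (PairSeparated A' B) T
pairs-separated-congˡ {B = B} =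
  All-pairs-cong {Q = λ X → PairSeparated X B} λ {X} {Y} → pair-separated-congˡ {A = X} {A' = Y}

cut⇒separated : (X : VSet n) (p : Fin n × Fin n) → cut X p ≡ true → PairSeparated X (∁ X) p
cut⇒separated X (s , t) cut≡true with X s | X t
cut⇒separated X (s , t) _  | true  | false = inj₁ (inj₁ (refl , refl))
cut⇒separated X (s , t) _  | false | true  = inj₁ (inj₂ (refl , refl))
cut⇒separated X (s , t) () | true  | true
cut⇒separated X (s , t) () | false | false

separated⇒cut : {A B : VSet n} → Disjoint A B → Integral A B →
  (p : Fin n × Fin n) → PairSeparated A B p → cut A p ≡ true
separated⇒cut {A = A} disjoint _ (s , t) (inj₁ (inj₁ (s∈A , t∈B))) =
  cut-∈∉ {X = A} s∈A (disjoint⇒∉ disjoint t∈B)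
separated⇒cut {A = A} disjoint _ (s , t) (inj₁ (inj₂ (t∈A , s∈B))) =
  cut-∉∈ {X = A} (disjoint⇒∉ disjoint s∈B) t∈A
separated⇒cut _ total (s , t) (inj₂ (s∉A , s∉B , _)) with total s
... | inj₁ s∈A = ⊥-elim (not-¬ s∈A s∉A)
... | inj₂ s∈B = ⊥-elim (not-¬ s∈B s∉B)

splits⇒separation : ∀ T → Splits T X → IsTerminalSeparation T X (∁ X)
splits⇒separation {X = X} _ splits =
  (λ v (v∈X , v∈∁X) → not-¬ v∈X (∈∁⇒∉ {X = X} v∈∁X)) , All.map (λ {p} → cut⇒separated X p) splits

reorient : VSet n → Fin n → Fin n → VSet n
reorient X s t = updateAt (updateAt X s (const true)) t (const false)

reorient-∈ : s ≢ t → s ∈ reorient X s t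
reorient-∈ {s = s} {t = t} {X = X} s≢t =
  trans (updateAt-minimal s t (updateAt X s (const true)) s≢t) (updateAt-updates s X)

reorient-∉ : t ∉ reorient X s t
reorient-∉ {t = t} {X = X} {s = s} = updateAt-updates t (updateAt X s (const true))

reorient-other : v ≢ s → v ≢ t → reorient X s t v ≡ X v
reorient-other {v = v} {s = s} {t = t} {X = X} v≢s v≢t =
  trans (updateAt-minimal v t (updateAt X s (const true)) v≢t) (updateAt-minimal v s X v≢s)

-- Pairs avoiding A ∪ B are oriented one at a time; since terminals are
-- distinct, reorienting one pair leaves the others split.
orientation : ∀ {A B : VSet n} T → PairwiseDisjoint T → IsTerminalSeparation T A B →
  ∃ λ X → Splits T X × Extends X (∁ X) A B
orientation {A = A} [] _ (disjoint , []) =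
  A , [] , (λ _ v∈A → v∈A) , λ v v∈B → ∉⇒∈∁ {X = A} (disjoint⇒∉ disjoint v∈B)
orientation {A = A} {B = B} ((s , t) ∷ T) ((s≢t ∷ s∉T) ∷ t∉T ∷ unique)
            (disjoint , separated ∷ separations) with orientation T unique (disjoint , separations)
... | X , splits , A⊆X , B⊆∁X with separated
...   | inj₁ (inj₁ (s∈A , t∈B)) =
  X , cut-∈∉ {X = X} (A⊆X s s∈A) (∈∁⇒∉ {X = X} (B⊆∁X t t∈B)) ∷ splits , A⊆X , B⊆∁X
...   | inj₁ (inj₂ (t∈A , s∈B)) =
  X , cut-∉∈ {X = X} (∈∁⇒∉ {X = X} (B⊆∁X s s∈B)) (A⊆X t t∈A) ∷ splits , A⊆X , B⊆∁X
...   | inj₂ (s∉A , s∉B , t∉A , t∉B) =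
  reorient X s t , cut-∈∉ {X = reorient X s t} (reorient-∈ {X = X} s≢t) (reorient-∉ {X = X})
    ∷ splits-cong T agree splits , A⊆X' , B⊆∁X'
  where
  agree : AgreeOnTerminals T X (reorient X s t)
  agree v v∈T = sym (reorient-other {X = X} (≢-sym (All.lookup s∉T v∈T)) (≢-sym (All.lookup t∉T v∈T)))
  A⊆X' : A ⊆ reorient X s t
  A⊆X' v v∈A =
    trans (reorient-other {X = X} (∈∉⇒≢ {X = A} v∈A s∉A) (∈∉⇒≢ {X = A} v∈A t∉A)) (A⊆X v v∈A)
  B⊆∁X' : B ⊆ ∁ (reorient X s t)
  B⊆∁X' v v∈B =
    trans (cong not (reorient-other {X = X} (∈∉⇒≢ {X = B} v∈B s∉B) (∈∉⇒≢ {X = B} v∈B t∉B)))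
          (B⊆∁X v v∈B)

module _ (I : Instance n) where

  -- An integral separation (X, V ∖ X) is represented by X alone.
  Feasible : VSet n → Set
  Feasible X = Splits (T I) X × Extends X (∁ X) (A° I) (B° I)

  feasible? : ∀ X → Dec (Feasible X)
  feasible? X = All.all? (λ p → cut X p ≟ true) (T I)
         ×-dec all? (λ v → A° I v ≟ true →-dec X v ≟ true)
         ×-dec all? (λ v → B° I v ≟ true →-dec not (X v) ≟ true)

  feasible-resp : X ≗ Y → Feasible X → Feasible Y
  feasible-resp X≗Y (splits , A°⊆X , B°⊆∁X) =
      splits-cong (T I) (λ v _ → X≗Y v) splits
    , (λ v v∈A° → trans (sym (X≗Y v)) (A°⊆X v v∈A°))
    , (λ v v∈B° → trans (cong not (sym (X≗Y v))) (B°⊆∁X v v∈B°))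

  cost : VSet n → ℕ
  cost X = cost2 (G I) X (∁ X)

  cost-resp : X ≗ Y → cost X ≡ cost Y
  cost-resp X≗Y = cong₂ _+_ (d-cong (G I) X≗Y) (d-cong (G I) (cong not ∘ X≗Y))

  cost≡d+d : ∀ X → cost X ≡ d (G I) X + d (G I) X
  cost≡d+d X = cong (d (G I) X +_) (d-∁ (G I) X)

  Optimal : VSet n → Set
  Optimal = Minimiser Feasible cost

  optimal-exists : ∃ Optimal
  optimal-exists = minimiser feasible? feasible-resp cost cost-resp (orientation (T I) (disj I) (sep° I))

  integral⇒feasible : ∀ {A B} → IsTerminalSeparation (T I) A B → Integral A B → Extends A B (A° I) (B° I)
    → Feasible A × cost2 (G I) A B ≡ cost A
  integral⇒feasible {A} {B} (disjoint , separated) total (A°⊆A , B°⊆B) =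
      (All.map (λ {p} → separated⇒cut disjoint total p) separated
      , A°⊆A , λ v v∈B° → trans (sym (B≗∁A v)) (B°⊆B v v∈B°))
    , cong (d (G I) A +_) (d-cong (G I) B≗∁A)
    where
    B≗∁A : B ≗ ∁ A
    B≗∁A = disjoint-total⇒≗∁ disjoint total

  optimal⇒minimum-separation : ∀ {X} (A : VSet n) → Optimal X →
    (∀ v → v ∈ A → v ∉ A° I → v ∈ X) ⊎ (∀ v → v ∈ A → v ∉ A° I → v ∈ ∁ X) →
    Σ (VSet n) λ A* → Σ (VSet n) λ B* →
      IsTerminalSeparation (T I) A* B* × Integral A* B* × Extends A* B* (A° I) (B° I) ×
      (∀ A' B' → IsTerminalSeparation (T I) A' B' → Integral A' B' → Extends A' B' (A° I) (B° I)
         → cost2 (G I) A* B* ≤ cost2 (G I) A' B') ×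
      ((∀ v → v ∈ A → v ∉ A° I → v ∈ A*) ⊎ (∀ v → v ∈ A → v ∉ A° I → v ∈ B*))
  optimal⇒minimum-separation {X} _ ((splits , extends) , minimal) A∖A°-placed =
    X , ∁ X , splits⇒separation (T I) splits , ∁-integral X , extends , minimum , A∖A°-placed
    where
    minimum : ∀ A' B' → IsTerminalSeparation (T I) A' B' → Integral A' B' → Extends A' B' (A° I) (B° I)
      → cost X ≤ cost2 (G I) A' B'
    minimum A' B' separation total extends' with integral⇒feasible separation total extends'
    ... | feasible , cost≡ = subst (cost X ≤_) (sym cost≡) (minimal A' feasible)

  module _ {A : VSet n} (extension : IsExtension I A) (free : TerminalFree I A) where

    agrees-A° : AgreeOnTerminals (T I) A (A° I)
    agrees-A° v terminal with A v in v∈A? | A° I v in v∈A°?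
    ... | true  | true  = refl
    ... | false | false = refl
    ... | true  | false = ⊥-elim (free v v∈A? v∈A°? terminal)
    ... | false | true  = ⊥-elim (not-¬ (proj₁ extension v v∈A°?) v∈A?)

    terminal-∈A⇒∈ : A° I ⊆ X → ∀ v → IsTerminal (T I) v → v ∈ A → v ∈ X
    terminal-∈A⇒∈ A°⊆X v terminal v∈A = A°⊆X v (trans (sym (agrees-A° v terminal)) v∈A)

    ∪-feasible : Feasible X → Feasible (X ∪ A)
    ∪-feasible {X} (splits , A°⊆X , B°⊆∁X) =
        splits-cong (T I) (λ v terminal → sym (∨-absorbs-below (terminal-∈A⇒∈ A°⊆X v terminal))) splits
      , (λ v v∈A° → cong (_∨ A v) (A°⊆X v v∈A°))
      , λ v v∈B° → ∉⇒∈∁ {X = X ∪ A} (∪-∉ {X = X} {Y = A} (∈∁⇒∉ {X = X} (B°⊆∁X v v∈B°))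
                                              (disjoint⇒∉ (⊆∁⇒disjoint (proj₂ extension)) v∈B°))

    ∩-strict-extension : Feasible X → (∃ λ w → w ∈ A × w ∉ A° I × w ∈ X) →
      IsTerminalSeparation (T I) (X ∩ A) (B° I) × Extends (X ∩ A) (B° I) (A° I) (B° I)
        × ¬ SameSep (X ∩ A) (B° I) (A° I) (B° I)
    ∩-strict-extension {X} (_ , A°⊆X , _) (w , w∈A , w∉A° , w∈X) =
        ( (λ v (v∈X∩A , v∈B°) → ⊆∁⇒disjoint (proj₂ extension) v (∩⁻ʳ {X = X} {Y = A} v∈X∩A , v∈B°))
        , pairs-separated-congˡ (T I) agree (proj₂ (sep° I)) )
      , ((λ v v∈A° → ∩⁺ {X = X} {Y = A} (A°⊆X v v∈A°) (proj₁ extension v v∈A°)) , (λ _ v∈B° → v∈B°))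
      , λ same → not-¬ (trans (sym (proj₁ (same w))) (∩⁺ {X = X} {Y = A} w∈X w∈A)) w∉A°
      where
      agree : AgreeOnTerminals (T I) (A° I) (X ∩ A)
      agree v terminal =
        sym (trans (∧-absorbs-below (terminal-∈A⇒∈ A°⊆X v terminal)) (agrees-A° v terminal))

    optimal-∪ : Maximal I → d (G I) A ≡ suc (d (G I) (A° I)) → Optimal X →
      (∃ λ w → w ∈ A × w ∉ A° I × w ∈ X) → Optimal (X ∪ A)
    optimal-∪ {X} maximal dA≡ (feasible , minimal) meets =
      ∪-feasible feasible , λ Y feasibleY → ≤-trans cost-∪≤ (minimal Y feasibleY)
      where
      open ≤-Reasoning
      dA≤d∩ : d (G I) A ≤ d (G I) (X ∩ A)
      dA≤d∩ with ∩-strict-extension feasible meets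
      ... | separation , extends , different =
        subst (_≤ d (G I) (X ∩ A)) (sym dA≡)
          (+-cancelʳ-< (d (G I) (B° I)) _ _ (maximal _ _ separation extends different))
      d∪≤ : d (G I) (X ∪ A) ≤ d (G I) X
      d∪≤ = +-cancelʳ-≤ (d (G I) (X ∩ A)) _ _ (begin
        d (G I) (X ∪ A) + d (G I) (X ∩ A)  ≤⟨ d-submodular (G I) X A ⟩
        d (G I) X + d (G I) A              ≤⟨ +-monoʳ-≤ (d (G I) X) dA≤d∩ ⟩
        d (G I) X + d (G I) (X ∩ A)        ∎)
      cost-∪≤ : cost (X ∪ A) ≤ cost X
      cost-∪≤ = subst₂ _≤_ (sym (cost≡d+d (X ∪ A))) (sym (cost≡d+d X)) (+-mono-≤ d∪≤ d∪≤)

lemma4p3 : ∀ {n} (I : Instance n) → Maximal I →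
    (A : VSet n) → IsExtension I A → TerminalFree I A →
    d (G I) A ≡ suc (d (G I) (A° I)) →
    Σ (VSet n) λ A* → Σ (VSet n) λ B* →
      IsTerminalSeparation (T I) A* B* × Integral A* B* × Extends A* B* (A° I) (B° I) ×
      (∀ A' B' → IsTerminalSeparation (T I) A' B' → Integral A' B' → Extends A' B' (A° I) (B° I)
         → cost2 (G I) A* B* ≤ cost2 (G I) A' B') ×
      ((∀ v → v ∈ A → v ∉ A° I → v ∈ A*) ⊎ (∀ v → v ∈ A → v ∉ A° I → v ∈ B*))
lemma4p3 I maximal A extension free dA≡ with optimal-exists I
... | X , optimal with any? (λ v → A v ≟ true ×-dec A° I v ≟ false ×-dec X v ≟ true)
...   | yes meets =
  optimal⇒minimum-separation I A (optimal-∪ I extension free maximal dA≡ optimal meets)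
    (inj₁ λ _ v∈A _ → ∪⁺ʳ {Y = A} {X = X} v∈A)
...   | no misses =
  optimal⇒minimum-separation I A optimal
    (inj₂ λ v v∈A v∉A° → ∉⇒∈∁ {X = X} (¬-not λ v∈X → misses (v , v∈A , v∉A° , v∈X)))
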